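{- AIP is sound for bisimilarity on $T(\Sigma_{FTP_/})$: for all closed terms $t,t'\in T(\Sigma_{FTP_/})$, if $t/c^n\sim t'/c^n$ for every $n\in\mathbb{N}$, then $t\sim t'$.
   Context: Fix finite nonempty actions $\mathcal{A}$, finite predicates $\mathcal{P}$, $\mathcal{P}^I\subseteq\mathcal{P}$ and sets $\mathcal{A}_P\subseteq\mathcal{A}$ ($P\in\mathcal{P}^I$). $FTP$ has signature $\Sigma_{FTP}$: constant $\delta$, constants $\kappa_P$ ($P\in\mathcal{P}$), prefixes $a.\_$ ($a\in\mathcal{A}$), binary $+$, and rules $a.x\xrightarrow{a}x$; $x\xrightarrow{a}x'\Rightarrow x+y\xrightarrow{a}x'$; $y\xrightarrow{a}y'\Rightarrow x+y\xrightarrow{a}y'$; $P\kappa_P$; $Px\Rightarrow P(x+y)$; $Py\Rightarrow P(x+y)$; $Px\Rightarrow P(a.x)$ for $P\in\mathcal{P}^I,a\in\mathcal{A}_P$. $FTP_/$ extends $FTP$ with a binary operation $/$ and rules: if $x\xrightarrow{a}x'$ and $h\xrightarrow{c}h'$ then $x/h\xrightarrow{a}x'/h'$ (for all actions $a,c$); if $Px$ then $P(x/h)$ (for all $P\in\mathcal{P}$). Semantics are the least relations on closed terms closed under these rules. For a fixed action $c$, $c^0=\delta$ and $c^{n+1}=c.c^n$. $\sim$ is bisimilarity: the largest symmetric relation on closed terms whose pairs match each other's transitions into related pairs and satisfy the same predicates. -}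

module Defs where

open import Data.Nat using (ℕ; zero; suc)
open import Data.Fin using (Fin)
open import Data.Fin.Subset using (Subset; _∈_)
open import Data.Product using (Σ; ∃; _×_; _,_)
open import Level using (Level; suc; zero)

-- Parameters of FTP: finite nonempty action set 𝒜 = Fin (suc k),
-- finite predicate set 𝒫 = Fin nP, 𝒫^I ⊆ 𝒫 and 𝒜_P ⊆ 𝒜 for P ∈ 𝒫^I.
record Params : Set where
  field
    k   : ℕ
    nP  : ℕ
    PI  : Subset nP
    AP  : Fin nP → Subset (Data.Nat.suc k)  -- 𝒜_P (only used for P ∈ 𝒫^I)

module _ (S : Params) where
  open Params S

  Act : Set
  Act = Fin (Data.Nat.suc k)

  Pred : Set
  Pred = Fin nP

  data Term : Set where
    δ   : Term
    κ   : Pred → Term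
    _∙_ : Act → Term → Term
    _⊕_ : Term → Term → Term
    _／_ : Term → Term → Term

  data Step : Term → Act → Term → Set where
    pre  : ∀ a x → Step (a ∙ x) a x
    sumˡ : ∀ {x y a x'} → Step x a x' → Step (x ⊕ y) a x'
    sumʳ : ∀ {x y a y'} → Step y a y' → Step (x ⊕ y) a y'
    slash : ∀ {x h a c x' h'} → Step x a x' → Step h c h' → Step (x ／ h) a (x' ／ h')

  data Holds : Pred → Term → Set where
    const : ∀ P → Holds P (κ P)
    sumˡ  : ∀ {P x y} → Holds P x → Holds P (x ⊕ y)
    sumʳ  : ∀ {P x y} → Holds P y → Holds P (x ⊕ y)
    prefI : ∀ {P x a} → P ∈ PI → a ∈ AP P → Holds P x → Holds P (a ∙ x)
    slash : ∀ {P x h} → Holds P x → Holds P (x ／ h)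

  record IsBisimulation (R : Term → Term → Set) : Set where
    field
      symm  : ∀ {t u} → R t u → R u t
      trans : ∀ {t u a t'} → R t u → Step t a t' → Σ Term (λ u' → Step u a u' × R t' u')
      preds : ∀ {t u P} → R t u → Holds P t → Holds P u

  _∼_ : Term → Term → Set₁
  t ∼ u = Σ (Term → Term → Set) (λ R → IsBisimulation R × R t u)

  _^_ : Act → ℕ → Term
  c ^ zero = δ
  c ^ Data.Nat.suc n = c ∙ (c ^ n)

module Submission where

-- Idea: every transition strictly decreases the prefix depth of a term, so
-- a term t can perform at most  depth t  consecutive transitions.  The term
-- c^m only ever steps  c^(m+1) --c--> c^m , and a slash x / h moves exactly
-- when x and h move together while carrying the predicates of x.  Hence
-- x / c^m  behaves like  x  as long as  depth x ≤ m : the "clock" c^m never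
-- runs out before x does.
--
-- Given one
-- bisimulation R₀ we show that the relation "x / c^m R₀ y / c^m for some m
-- bounding the depths of x and y" is itself a bisimulation, so one clock
-- outlasting both terms already yields bisimilarity.  The theorem follows by
-- instantiating the hypothesis at  n = depth t ⊔ depth t' .

open import Defs
open import Data.Nat using (ℕ; zero; suc; _≤_; _<_; _⊔_; s≤s⁻¹)
open import Data.Nat.Properties using (≤-refl; ≤-trans; <-≤-trans; m≤m⊔n; m≤n⊔m)
open import Data.Product using (Σ; _×_; _,_)
open import Relation.Binary.PropositionalEquality using (_≡_; refl)
open import Relation.Nullary using (¬_)
open import Data.Empty using (⊥-elim)

module Depth (S : Params) where

  -- The prefix depth: the longest chain of action prefixes in a term.
  -- In a slash x / h only x is counted, since x / h stops as soon as x does.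
  depth : Term S → ℕ
  depth δ       = 0
  depth (κ _)   = 0
  depth (a ∙ x) = suc (depth x)
  depth (x ⊕ y) = depth x ⊔ depth y
  depth (x ／ h) = depth x

  step-decreases-depth : ∀ {x a x'} → Step S x a x' → depth x' < depth x
  step-decreases-depth (pre a x) = ≤-refl
  step-decreases-depth (sumˡ {x} {y} s) =
    ≤-trans (step-decreases-depth s) (m≤m⊔n (depth x) (depth y))
  step-decreases-depth (sumʳ {x} {y} s) =
    ≤-trans (step-decreases-depth s) (m≤n⊔m (depth x) (depth y))
  step-decreases-depth (slash s _) = step-decreases-depth s

  step-lowers-bound : ∀ {x a x' m} → Step S x a x' → depth x ≤ suc m → depth x' ≤ m
  step-lowers-bound s bound = s≤s⁻¹ (<-≤-trans (step-decreases-depth s) bound)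

  no-step-at-depth-zero : ∀ {x a x'} → depth x ≤ 0 → ¬ Step S x a x'
  no-step-at-depth-zero bound s with <-≤-trans (step-decreases-depth s) bound
  ... | ()

module SlashByPowers (S : Params) (c : Act S) where
  open Depth S

  slash-follows : ∀ {x a x' m} → Step S x a x' →
                  Step S (x ／ _^_ S c (suc m)) a (x' ／ _^_ S c m)
  slash-follows {m = m} s = slash s (pre c (_^_ S c m))

  slash-step-inversion : ∀ {y a z m} → Step S (y ／ _^_ S c (suc m)) a z →
                         Σ (Term S) (λ y' → Step S y a y' × z ≡ (y' ／ _^_ S c m))
  slash-step-inversion (slash s (pre _ _)) = _ , s , refl

  slash-holds⁻¹ : ∀ {P x h} → Holds S P (x ／ h) → Holds S P x
  slash-holds⁻¹ (slash p) = p

  module _ (R₀ : Term S → Term S → Set) (B : IsBisimulation S R₀) where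
    open IsBisimulation B

    ClockRelated : Term S → Term S → Set
    ClockRelated x y =
      Σ ℕ (λ m → depth x ≤ m × depth y ≤ m × R₀ (x ／ _^_ S c m) (y ／ _^_ S c m))

    clockRelated-symm : ∀ {x y} → ClockRelated x y → ClockRelated y x
    clockRelated-symm (m , dx , dy , r) = m , dy , dx , symm r

    -- A step of x is matched through R₀ by the slashed terms, using up one
    -- tick of the clock; a clock of 0 is impossible since x can still move.
    clockRelated-trans : ∀ {x y a x'} → ClockRelated x y → Step S x a x' →
                         Σ (Term S) (λ y' → Step S y a y' × ClockRelated x' y')
    clockRelated-trans (zero , dx , _ , _) s = ⊥-elim (no-step-at-depth-zero dx s)
    clockRelated-trans (suc m , dx , dy , r) s
      with trans r (slash-follows s)
    ... | _ , s₀ , r' with slash-step-inversion s₀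
    ...   | y' , s' , refl =
      y' , s' , (m , step-lowers-bound s dx , step-lowers-bound s' dy , r')

    clockRelated-preds : ∀ {x y P} → ClockRelated x y → Holds S P x → Holds S P y
    clockRelated-preds (_ , _ , _ , r) p = slash-holds⁻¹ (preds r (slash p))

    clockRelated-isBisimulation : IsBisimulation S ClockRelated
    clockRelated-isBisimulation = record
      { symm  = clockRelated-symm
      ; trans = clockRelated-trans
      ; preds = clockRelated-preds
      }

  bisimilar-from-long-clock : ∀ {x y} m → depth x ≤ m → depth y ≤ m →
                              _∼_ S (x ／ _^_ S c m) (y ／ _^_ S c m) → _∼_ S x y
  bisimilar-from-long-clock m dx dy (R₀ , B , r) =
    ClockRelated R₀ B , clockRelated-isBisimulation R₀ B , (m , dx , dy , r)

lemma22 : (S : Params) (c : Act S) (t t' : Term S) →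
          ((n : ℕ) → _∼_ S (t ／ _^_ S c n) (t' ／ _^_ S c n)) →
          _∼_ S t t'
lemma22 S c t t' bisimilar-under-clock =
  bisimilar-from-long-clock n (m≤m⊔n (depth t) (depth t')) (m≤n⊔m (depth t) (depth t'))
    (bisimilar-under-clock n)
  where
  open Depth S
  open SlashByPowers S c
  n : ℕ
  n = depth t ⊔ depth t'
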